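{- For all integers $5\le a<b$, there exists a connected graph $G$ such that $trc(G)=a$ and $strc(G)=b$.
   Context: All graphs are finite and simple. A total-coloured path (vertices and edges coloured) is total-rainbow if its edges and internal vertices have pairwise distinct colours. $trc(G)$ is the minimum number of colours in a total-colouring of $G$ in which any two vertices are joined by a total-rainbow path; $strc(G)$ is the minimum number of colours in a total-colouring in which any two vertices $u,v$ are joined by a total-rainbow $u$–$v$ geodesic (a $u$–$v$ path of length $d(u,v)$). -}

module Defs where

open import Data.Nat using (ℕ; zero; suc; _<_)
open import Data.Fin using (Fin)
open import Data.Bool using (Bool; true; false)
open import Data.List using (List; []; _∷_; map; _++_; length)
open import Data.List.Relation.Unary.Unique.Propositional using (Unique)
open import Data.Product using (Σ; _×_; _,_; ∃; ∃-syntax)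
open import Relation.Binary.PropositionalEquality using (_≡_)
open import Relation.Nullary using (¬_)

record Graph : Set where
  field
    n      : ℕ
    E      : Fin n → Fin n → Bool
    E-sym  : ∀ u v → E u v ≡ E v u
    E-irr  : ∀ v → E v v ≡ false
open Graph public

data Walk (G : Graph) : Fin (n G) → Fin (n G) → Set where
  [_]    : (v : Fin (n G)) → Walk G v v
  _∷⟨_⟩_ : (u : Fin (n G)) {w v : Fin (n G)} → E G u w ≡ true → Walk G w v → Walk G u v

module _ {G : Graph} where
  vertices : ∀ {u v} → Walk G u v → List (Fin (n G))
  vertices [ v ] = v ∷ []
  vertices (u ∷⟨ _ ⟩ r) = u ∷ vertices r

  allButLast : ∀ {u v} → Walk G u v → List (Fin (n G))
  allButLast [ v ] = []
  allButLast (u ∷⟨ _ ⟩ r) = u ∷ allButLast r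

  internal : ∀ {u v} → Walk G u v → List (Fin (n G))
  internal [ v ] = []
  internal (u ∷⟨ _ ⟩ r) = allButLast r

  edges : ∀ {u v} → Walk G u v → List (Fin (n G) × Fin (n G))
  edges [ v ] = []
  edges (u ∷⟨ _ ⟩ ([ v ])) = (u , v) ∷ []
  edges (u ∷⟨ _ ⟩ (w ∷⟨ p ⟩ r)) = (u , w) ∷ edges (w ∷⟨ p ⟩ r)

  len : ∀ {u v} → Walk G u v → ℕ
  len [ v ] = 0
  len (u ∷⟨ _ ⟩ r) = suc (len r)

  IsPath : ∀ {u v} → Walk G u v → Set
  IsPath w = Unique (vertices w)

  IsGeodesic : ∀ {u v} → Walk G u v → Set
  IsGeodesic {u} {v} w = IsPath w × (∀ (w' : Walk G u v) → IsPath w' → ¬ (len w' < len w))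

Connected : Graph → Set
Connected G = ∀ (u v : Fin (n G)) → Σ (Walk G u v) IsPath

-- A total-colouring of G with (at most) k colours: every vertex and every
-- edge gets a colour in Fin k (edge colour is symmetric in the endpoints;
-- values on non-adjacent pairs are irrelevant).  No properness is required.
record TotalColouring (G : Graph) (k : ℕ) : Set where
  field
    vcol     : Fin (n G) → Fin k
    ecol     : Fin (n G) → Fin (n G) → Fin k
    ecol-sym : ∀ u v → ecol u v ≡ ecol v u
open TotalColouring public

module _ {G : Graph} {k : ℕ} (c : TotalColouring G k) where
  totalColours : ∀ {u v} → Walk G u v → List (Fin k)
  totalColours w = map (λ e → ecol c (Data.Product.proj₁ e) (Data.Product.proj₂ e)) (edges w)
                   ++ map (vcol c) (internal w)

  TotalRainbow : ∀ {u v} → Walk G u v → Set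
  TotalRainbow w = Unique (totalColours w)

  TotalRainbowConnected : Set
  TotalRainbowConnected = ∀ (u v : Fin (n G)) → ∃[ w ] (IsPath {G} {u} {v} w × TotalRainbow w)

  StronglyTotalRainbowConnected : Set
  StronglyTotalRainbowConnected = ∀ (u v : Fin (n G)) → ∃[ w ] (IsGeodesic {G} {u} {v} w × TotalRainbow w)

trcIs : Graph → ℕ → Set
trcIs G a = Σ (TotalColouring G a) TotalRainbowConnected
          × (∀ k → k < a → ∀ (c : TotalColouring G k) → ¬ TotalRainbowConnected c)

strcIs : Graph → ℕ → Set
strcIs G b = Σ (TotalColouring G b) StronglyTotalRainbowConnected
           × (∀ k → k < b → ∀ (c : TotalColouring G k) → ¬ StronglyTotalRainbowConnected c)

module Submission where

-- The graph realising trc = a and strc = b (5 ≤ a < b) is a cone: a hub joined to every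
-- vertex of a rim consisting of p = a - 1 isolated leaves and q = b - a disjoint edges.
--
-- Lower bounds (hub-colour-bound): if m vertices are pairwise forced to be joined by
-- the 2-path u h v through a common neighbour h, then the colour of h and the colours
-- of the m edges at h are pairwise distinct, so m + 1 colours are needed.  For rainbow
-- paths this applies to the leaves, which are pendant at the hub; for rainbow
-- geodesics to the leaves together with one end of each rim edge, since these are
-- pairwise non-adjacent with the hub as their only common neighbour.
--
-- Upper bounds: with p + q private spoke colours every non-adjacent pair is joined by
-- a rainbow geodesic through the hub; with p + 1 colours (p ≥ 4) the rim-edge ends
-- reuse the colours of leaves 0 and 1, and clashing pairs detour through a rim edge.

open import Defs
open import Data.Nat using (ℕ; zero; suc; _≤_; _<_; _+_; z≤n; s≤s)
open import Data.Nat.Properties using (<⇒≱; <⇒≤; m≤n⇒∃[o]m+o≡n)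
open import Data.Fin using (Fin; zero; suc; _↑ˡ_; _↑ʳ_; splitAt; join; _≟_; #_)
open import Data.Fin.Properties
  using (suc-injective; splitAt-↑ˡ; splitAt-↑ʳ; splitAt-join; join-splitAt; injective⇒≤)
open import Data.Bool using (Bool; true; false)
open import Data.Sum using (_⊎_; inj₁; inj₂)
open import Data.Product using (Σ; _×_; _,_; ∃-syntax)
open import Data.List using (List; []; _∷_)
open import Data.List.Membership.Propositional using (_∈_)
open import Data.List.Relation.Unary.Any using (here; there)
open import Data.List.Relation.Unary.All as All using ([]; _∷_)
open import Data.List.Relation.Unary.AllPairs using ([]; _∷_)
open import Data.List.Relation.Unary.Unique.Propositional using (Unique)
import Data.List.Relation.Unary.Unique.DecPropositional as UniqueDec
open import Data.Empty using (⊥-elim)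
open import Function using (_∘_)
open import Relation.Nullary using (¬_; yes; no; does)
open import Relation.Nullary.Decidable using (True; toWitness; dec-true; map′; does-≡)
open import Relation.Binary.PropositionalEquality
  using (_≡_; _≢_; refl; sym; trans; cong; cong₂; subst)

distinct : ∀ {k} {cs : List (Fin k)} → True (UniqueDec.unique? _≟_ cs) → Unique cs
distinct = toWitness

≟-sym : ∀ {k} (i j : Fin k) → does (i ≟ j) ≡ does (j ≟ i)
≟-sym i j = does-≡ (i ≟ j) (map′ sym sym (j ≟ i))

≟-sound : ∀ {k} {i j : Fin k} → does (i ≟ j) ≡ true → i ≡ j
≟-sound {i = i} {j} e with i ≟ j
... | yes i≡j = i≡j
≟-sound () | no _

splitAt-injective : ∀ m {n} {s t : Fin (m + n)} → splitAt m s ≡ splitAt m t → s ≡ t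
splitAt-injective m {n} {s} {t} eq =
  trans (sym (join-splitAt m n s)) (trans (cong (join m n) eq) (join-splitAt m n t))

join-injective : ∀ m n {x y : Fin m ⊎ Fin n} → join m n x ≡ join m n y → x ≡ y
join-injective m n {x} {y} eq =
  trans (sym (splitAt-join m n x)) (trans (cong (splitAt m) eq) (splitAt-join m n y))

-- Walks in an arbitrary graph

module Walks (G : Graph) where

  adjacent⇒distinct : ∀ {u v} → E G u v ≡ true → u ≢ v
  adjacent⇒distinct {u} e refl with trans (sym e) (E-irr G u)
  ... | ()

  len-distinct : ∀ {u v} (w : Walk G u v) → u ≢ v → 1 ≤ len w
  len-distinct [ _ ] u≢v = ⊥-elim (u≢v refl)
  len-distinct (_ ∷⟨ _ ⟩ _) _ = s≤s z≤n

  len-nonadjacent : ∀ {u v} (w : Walk G u v) → u ≢ v → E G u v ≡ false → 2 ≤ len w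
  len-nonadjacent [ _ ] u≢v _ = ⊥-elim (u≢v refl)
  len-nonadjacent (_ ∷⟨ e ⟩ [ _ ]) _ ¬e with trans (sym e) ¬e
  ... | ()
  len-nonadjacent (_ ∷⟨ _ ⟩ (_ ∷⟨ _ ⟩ _)) _ _ = s≤s (s≤s z≤n)

  twoStep : ∀ {u m v} → E G u m ≡ true → E G m v ≡ true → Walk G u v
  twoStep {u} {m} {v} e₁ e₂ = u ∷⟨ e₁ ⟩ (m ∷⟨ e₂ ⟩ [ v ])

  twoStep-isPath : ∀ {u m v} (e₁ : E G u m ≡ true) (e₂ : E G m v ≡ true) → u ≢ v →
                   IsPath (twoStep e₁ e₂)
  twoStep-isPath e₁ e₂ u≢v =
    (adjacent⇒distinct e₁ ∷ u≢v ∷ []) ∷ (adjacent⇒distinct e₂ ∷ []) ∷ [] ∷ []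

  PendantAt : Fin (n G) → Fin (n G) → Set
  PendantAt h v = ∀ w → E G v w ≡ true → w ≡ h

  pendant-visits-hub : ∀ {h s t v} → PendantAt h v → (e : E G s t ≡ true) (r : Walk G t v) →
                       h ∈ vertices (s ∷⟨ e ⟩ r)
  pendant-visits-hub {s = s} {v = v} pv e [ _ ] = here (sym (pv s (trans (E-sym G v s) e)))
  pendant-visits-hub pv _ (_ ∷⟨ e ⟩ r) = there (pendant-visits-hub pv e r)

  rainbow⇒connected : ∀ {k} {c : TotalColouring G k} → TotalRainbowConnected c → Connected G
  rainbow⇒connected rc u v = let (w , isPath , _) = rc u v in w , isPath

-- Rainbow paths and the colours of 2-paths

module _ {G : Graph} {k : ℕ} (c : TotalColouring G k) where
  open Walks G

  record RainbowPath (u v : Fin (n G)) (ℓ : ℕ) : Set where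
    constructor rainbowPath
    field
      walk    : Walk G u v
      isPath  : IsPath walk
      length  : len walk ≡ ℓ
      rainbow : TotalRainbow c walk

  hubColours : (u h v : Fin (n G)) → List (Fin k)
  hubColours u h v = ecol c u h ∷ ecol c h v ∷ vcol c h ∷ []

  trivialPath : ∀ u → RainbowPath u u 0
  trivialPath u = rainbowPath [ u ] ([] ∷ []) refl []

  edgePath : ∀ {u v} → E G u v ≡ true → RainbowPath u v 1
  edgePath {u} {v} e =
    rainbowPath (u ∷⟨ e ⟩ [ v ]) ((adjacent⇒distinct e ∷ []) ∷ [] ∷ []) refl ([] ∷ [])

  twoStepPath : ∀ {u m v} (e₁ : E G u m ≡ true) (e₂ : E G m v ≡ true) → u ≢ v →
                Unique (hubColours u m v) → RainbowPath u v 2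
  twoStepPath e₁ e₂ u≢v rainbow =
    rainbowPath (twoStep e₁ e₂) (twoStep-isPath e₁ e₂ u≢v) refl rainbow

  threeStepPath : ∀ {u m₁ m₂ v} (e₁ : E G u m₁ ≡ true) (e₂ : E G m₁ m₂ ≡ true)
                  (e₃ : E G m₂ v ≡ true) → u ≢ m₂ → m₁ ≢ v → u ≢ v →
                  Unique (ecol c u m₁ ∷ ecol c m₁ m₂ ∷ ecol c m₂ v ∷
                          vcol c m₁ ∷ vcol c m₂ ∷ []) →
                  RainbowPath u v 3
  threeStepPath {u} {m₁} {m₂} {v} e₁ e₂ e₃ u≢m₂ m₁≢v u≢v rainbow =
    rainbowPath (u ∷⟨ e₁ ⟩ (m₁ ∷⟨ e₂ ⟩ (m₂ ∷⟨ e₃ ⟩ [ v ])))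
      ((adjacent⇒distinct e₁ ∷ u≢m₂ ∷ u≢v ∷ []) ∷ (adjacent⇒distinct e₂ ∷ m₁≢v ∷ []) ∷
       (adjacent⇒distinct e₃ ∷ []) ∷ [] ∷ [])
      refl rainbow

  -- Two distinct vertices pendant at h are joined by no path other than u h v.
  pendant-path-colours : ∀ {h u v} → PendantAt h u → PendantAt h v → u ≢ v →
                         (w : Walk G u v) → IsPath w → totalColours c w ≡ hubColours u h v
  pendant-path-colours _ _ u≢v [ _ ] _ = ⊥-elim (u≢v refl)
  pendant-path-colours {u = u} pu pv u≢v (_ ∷⟨ e ⟩ [ v ]) _ =
    ⊥-elim (u≢v (trans (pv u (trans (E-sym G v u) e)) (sym (pu v e))))
  pendant-path-colours {u = u} pu _ _ (_ ∷⟨ e ⟩ (m ∷⟨ _ ⟩ [ v ])) _ =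
    cong (λ x → hubColours u x v) (pu m e)
  pendant-path-colours pu pv _ (_ ∷⟨ e ⟩ (m ∷⟨ _ ⟩ (_ ∷⟨ e′ ⟩ r))) (_ ∷ (m∉rest ∷ _)) =
    ⊥-elim (All.lookup m∉rest (pendant-visits-hub pv e′ r) (pu m e))

  -- If u, v are non-adjacent and h is their only common neighbour, the only u–v
  -- geodesic is u h v.
  geodesic-colours : ∀ {h u v} → u ≢ v → E G u v ≡ false → E G u h ≡ true → E G h v ≡ true →
                     (∀ m → E G u m ≡ true → E G m v ≡ true → m ≡ h) →
                     (w : Walk G u v) → IsGeodesic w → totalColours c w ≡ hubColours u h v
  geodesic-colours u≢v _ _ _ _ [ _ ] _ = ⊥-elim (u≢v refl)
  geodesic-colours _ ¬e _ _ _ (_ ∷⟨ e ⟩ [ _ ]) _ with trans (sym e) ¬e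
  ... | ()
  geodesic-colours {u = u} _ _ _ _ onlyHub (_ ∷⟨ e ⟩ (m ∷⟨ e′ ⟩ [ v ])) _ =
    cong (λ x → hubColours u x v) (onlyHub m e e′)
  geodesic-colours u≢v _ eu ev _ (_ ∷⟨ _ ⟩ (_ ∷⟨ _ ⟩ (_ ∷⟨ _ ⟩ _))) (_ , shortest) =
    ⊥-elim (shortest (twoStep eu ev) (twoStep-isPath eu ev u≢v) (s≤s (s≤s (s≤s z≤n))))

  pendant-hub-rainbow : TotalRainbowConnected c → ∀ {h u v} → PendantAt h u → PendantAt h v →
                        u ≢ v → Unique (hubColours u h v)
  pendant-hub-rainbow rc {u = u} {v} pu pv u≢v =
    let (w , isPath , rainbow) = rc u v
    in subst Unique (pendant-path-colours pu pv u≢v w isPath) rainbow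

  geodesic-hub-rainbow : StronglyTotalRainbowConnected c → ∀ {h u v} → u ≢ v → E G u v ≡ false →
                         E G u h ≡ true → E G h v ≡ true →
                         (∀ m → E G u m ≡ true → E G m v ≡ true → m ≡ h) →
                         Unique (hubColours u h v)
  geodesic-hub-rainbow src {u = u} {v} u≢v ¬e eu ev onlyHub =
    let (w , geodesic , rainbow) = src u v
    in subst Unique (geodesic-colours u≢v ¬e eu ev onlyHub w geodesic) rainbow

  -- If m + 2 vertices are pairwise joined through h with three distinct colours, then
  -- the colour of h and the colours of the edges from h to them are pairwise distinct,
  -- so at least m + 3 colours are used.
  hub-colour-bound : ∀ {m} (h : Fin (n G)) (u : Fin (suc (suc m)) → Fin (n G)) →
                     (∀ i j → i ≢ j → Unique (hubColours (u i) h (u j))) → 3 + m ≤ k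
  hub-colour-bound {m} h u separated = injective⇒≤ palette-injective
    where
    palette : Fin (3 + m) → Fin k
    palette zero    = vcol c h
    palette (suc i) = ecol c h (u i)

    another : Fin (suc (suc m)) → Fin (suc (suc m))
    another zero    = suc zero
    another (suc _) = zero

    another-≢ : ∀ i → i ≢ another i
    another-≢ zero    ()
    another-≢ (suc _) ()

    spoke≢hub : ∀ i → ecol c h (u i) ≢ vcol c h
    spoke≢hub i with separated i (another i) (another-≢ i)
    ... | (_ ∷ uᵢh≢h ∷ []) ∷ _ = uᵢh≢h ∘ trans (ecol-sym c (u i) h)

    spokes-distinct : ∀ i j → i ≢ j → ecol c h (u i) ≢ ecol c h (u j)
    spokes-distinct i j i≢j with separated i j i≢j
    ... | (uᵢh≢huⱼ ∷ _) ∷ _ = uᵢh≢huⱼ ∘ trans (ecol-sym c (u i) h)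

    palette-distinct : ∀ i j → i ≢ j → palette i ≢ palette j
    palette-distinct zero    zero    i≢j _ = i≢j refl
    palette-distinct zero    (suc j) _     = spoke≢hub j ∘ sym
    palette-distinct (suc i) zero    _     = spoke≢hub i
    palette-distinct (suc i) (suc j) i≢j   = spokes-distinct i j (i≢j ∘ cong suc)

    palette-injective : ∀ {i j} → palette i ≡ palette j → i ≡ j
    palette-injective {i} {j} eq with i ≟ j
    ... | yes i≡j = i≡j
    ... | no i≢j  = ⊥-elim (palette-distinct i j i≢j eq)

module _ {G : Graph} {k : ℕ} {c : TotalColouring G k} where

  rainbow-path : ∀ {u v ℓ} → RainbowPath c u v ℓ → ∃[ w ] (IsPath {G} {u} {v} w × TotalRainbow c w)
  rainbow-path (rainbowPath w isPath _ rainbow) = w , isPath , rainbow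

  rainbow-geodesic : ∀ {u v ℓ} → RainbowPath c u v ℓ → (∀ (w : Walk G u v) → ℓ ≤ len w) →
                     ∃[ w ] (IsGeodesic {G} {u} {v} w × TotalRainbow c w)
  rainbow-geodesic (rainbowPath w isPath refl rainbow) shortest =
    w , (isPath , λ w′ _ w′<w → <⇒≱ w′<w (shortest w′)) , rainbow

-- Graphs on an enumerated vertex type: a symmetric loopless relation adj on a type V
-- in bijection with Fin N, and colourings given on V.

module Enumerated {V : Set} {N : ℕ} (enc : V → Fin N) (dec : Fin N → V)
  (dec-enc : ∀ x → dec (enc x) ≡ x) (enc-dec : ∀ u → enc (dec u) ≡ u)
  (adj : V → V → Bool) (adj-sym : ∀ x y → adj x y ≡ adj y x) (adj-irr : ∀ x → adj x x ≡ false)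
  where

  graph : Graph
  graph = record { n = N ; E = λ u v → adj (dec u) (dec v)
                 ; E-sym = λ u v → adj-sym (dec u) (dec v) ; E-irr = λ u → adj-irr (dec u) }

  open Walks graph public

  dec⇒enc : ∀ {u x} → dec u ≡ x → u ≡ enc x
  dec⇒enc {u} du = trans (sym (enc-dec u)) (cong enc du)

  dec-injective : ∀ {u v} → dec u ≡ dec v → u ≡ v
  dec-injective {v = v} eq = trans (dec⇒enc eq) (enc-dec v)

  enc-injective : ∀ {x y} → enc x ≡ enc y → x ≡ y
  enc-injective {x} {y} eq = trans (sym (dec-enc x)) (trans (cong dec eq) (dec-enc y))

  E-enc : ∀ x y → E graph (enc x) (enc y) ≡ adj x y
  E-enc x y = cong₂ adj (dec-enc x) (dec-enc y)

  pendant-enc : ∀ {x z} → (∀ y → adj x y ≡ true → y ≡ z) → PendantAt (enc z) (enc x)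
  pendant-enc {x} onlyZ u e =
    dec⇒enc (onlyZ (dec u) (subst (λ a → adj a (dec u) ≡ true) (dec-enc x) e))

  commonNeighbour-enc : ∀ {x y z} → (∀ t → adj x t ≡ true → adj t y ≡ true → t ≡ z) →
                        ∀ m → E graph (enc x) m ≡ true → E graph m (enc y) ≡ true → m ≡ enc z
  commonNeighbour-enc {x} {y} onlyZ m e₁ e₂ =
    dec⇒enc (onlyZ (dec m) (subst (λ a → adj a (dec m) ≡ true) (dec-enc x) e₁)
                           (subst (λ b → adj (dec m) b ≡ true) (dec-enc y) e₂))

  module Coloured {k} (vc : V → Fin k) (ec : V → V → Fin k)
                  (ec-sym : ∀ x y → ec x y ≡ ec y x) where

    colouring : TotalColouring graph k
    colouring = record { vcol = vc ∘ dec ; ecol = λ u v → ec (dec u) (dec v)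
                       ; ecol-sym = λ u v → ec-sym (dec u) (dec v) }

    -- Rainbow paths described by the labels of the vertices they visit; the
    -- equations dec u ≡ x and dec v ≡ y name the labels of the endpoints.
    hop : ∀ {u v x y} → dec u ≡ x → dec v ≡ y → adj x y ≡ true → RainbowPath colouring u v 1
    hop refl refl e = edgePath colouring e

    hop2 : ∀ {u v x y} z → dec u ≡ x → dec v ≡ y → adj x z ≡ true → adj z y ≡ true → x ≢ y →
           Unique (ec x z ∷ ec z y ∷ vc z ∷ []) → RainbowPath colouring u v 2
    hop2 z = through (enc z) (dec-enc z)
      where
      through : ∀ {u v x y z} m → dec m ≡ z → dec u ≡ x → dec v ≡ y → adj x z ≡ true →
                adj z y ≡ true → x ≢ y → Unique (ec x z ∷ ec z y ∷ vc z ∷ []) →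
                RainbowPath colouring u v 2
      through _ refl refl refl e₁ e₂ x≢y = twoStepPath colouring e₁ e₂ (x≢y ∘ cong dec)

    hop3 : ∀ {u v x y} z₁ z₂ → dec u ≡ x → dec v ≡ y →
           adj x z₁ ≡ true → adj z₁ z₂ ≡ true → adj z₂ y ≡ true →
           x ≢ z₂ → z₁ ≢ y → x ≢ y →
           Unique (ec x z₁ ∷ ec z₁ z₂ ∷ ec z₂ y ∷ vc z₁ ∷ vc z₂ ∷ []) →
           RainbowPath colouring u v 3
    hop3 z₁ z₂ = through (enc z₁) (enc z₂) (dec-enc z₁) (dec-enc z₂)
      where
      through : ∀ {u v x y z₁ z₂} m₁ m₂ → dec m₁ ≡ z₁ → dec m₂ ≡ z₂ →
                dec u ≡ x → dec v ≡ y →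
                adj x z₁ ≡ true → adj z₁ z₂ ≡ true → adj z₂ y ≡ true →
                x ≢ z₂ → z₁ ≢ y → x ≢ y →
                Unique (ec x z₁ ∷ ec z₁ z₂ ∷ ec z₂ y ∷ vc z₁ ∷ vc z₂ ∷ []) →
                RainbowPath colouring u v 3
      through _ _ refl refl refl refl e₁ e₂ e₃ x≢z₂ z₁≢y x≢y =
        threeStepPath colouring e₁ e₂ e₃ (x≢z₂ ∘ cong dec) (z₁≢y ∘ cong dec) (x≢y ∘ cong dec)

-- The cone: a hub joined to every vertex of the rim graph made of p isolated leaves
-- and q disjoint edges leftᵢ – rightᵢ.

module Cone (p q : ℕ) where

  data Rim : Set where
    leaf        : Fin p → Rim
    left right  : Fin q → Rim

  data Vertex : Set where
    hub : Vertex
    rim : Rim → Vertex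

  rim-injective : ∀ {r s} → rim r ≡ rim s → r ≡ s
  rim-injective refl = refl

  rimAdj : Rim → Rim → Bool
  rimAdj (left i)  (right j) = does (i ≟ j)
  rimAdj (right i) (left j)  = does (i ≟ j)
  rimAdj _         _         = false

  rimAdj-sym : ∀ r s → rimAdj r s ≡ rimAdj s r
  rimAdj-sym (leaf _)  (leaf _)  = refl
  rimAdj-sym (leaf _)  (left _)  = refl
  rimAdj-sym (leaf _)  (right _) = refl
  rimAdj-sym (left _)  (leaf _)  = refl
  rimAdj-sym (left _)  (left _)  = refl
  rimAdj-sym (left i)  (right j) = ≟-sym i j
  rimAdj-sym (right _) (leaf _)  = refl
  rimAdj-sym (right i) (left j)  = ≟-sym i j
  rimAdj-sym (right _) (right _) = refl

  partner-lr : ∀ i → rimAdj (left i) (right i) ≡ true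
  partner-lr i = dec-true (i ≟ i) refl

  partner-rl : ∀ i → rimAdj (right i) (left i) ≡ true
  partner-rl i = dec-true (i ≟ i) refl

  adj : Vertex → Vertex → Bool
  adj hub     hub     = false
  adj hub     (rim _) = true
  adj (rim _) hub     = true
  adj (rim r) (rim s) = rimAdj r s

  adj-sym : ∀ x y → adj x y ≡ adj y x
  adj-sym hub     hub     = refl
  adj-sym hub     (rim _) = refl
  adj-sym (rim _) hub     = refl
  adj-sym (rim r) (rim s) = rimAdj-sym r s

  adj-irr : ∀ x → adj x x ≡ false
  adj-irr hub             = refl
  adj-irr (rim (leaf _))  = refl
  adj-irr (rim (left _))  = refl
  adj-irr (rim (right _)) = refl

  rimCode : Rim → Fin (p + (q + q))
  rimCode (leaf j)  = j ↑ˡ (q + q)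
  rimCode (left i)  = p ↑ʳ (i ↑ˡ q)
  rimCode (right i) = p ↑ʳ (q ↑ʳ i)

  rimOfEnd : Fin q ⊎ Fin q → Rim
  rimOfEnd (inj₁ i) = left i
  rimOfEnd (inj₂ i) = right i

  rimOfCode : Fin p ⊎ Fin (q + q) → Rim
  rimOfCode (inj₁ j) = leaf j
  rimOfCode (inj₂ k) = rimOfEnd (splitAt q k)

  rimAt : Fin (p + (q + q)) → Rim
  rimAt = rimOfCode ∘ splitAt p

  rimAt-rimCode : ∀ r → rimAt (rimCode r) ≡ r
  rimAt-rimCode (leaf j)  rewrite splitAt-↑ˡ p j (q + q) = refl
  rimAt-rimCode (left i)  rewrite splitAt-↑ʳ p (q + q) (i ↑ˡ q) | splitAt-↑ˡ q i q = refl
  rimAt-rimCode (right i) rewrite splitAt-↑ʳ p (q + q) (q ↑ʳ i) | splitAt-↑ʳ q q i = refl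

  rimCode-rimOfCode : ∀ s → rimCode (rimOfCode s) ≡ join p (q + q) s
  rimCode-rimOfCode (inj₁ j) = refl
  rimCode-rimOfCode (inj₂ k) = trans (ofEnd (splitAt q k)) (cong (p ↑ʳ_) (join-splitAt q q k))
    where
    ofEnd : ∀ t → rimCode (rimOfEnd t) ≡ p ↑ʳ join q q t
    ofEnd (inj₁ _) = refl
    ofEnd (inj₂ _) = refl

  rimCode-rimAt : ∀ i → rimCode (rimAt i) ≡ i
  rimCode-rimAt i = trans (rimCode-rimOfCode (splitAt p i)) (join-splitAt p (q + q) i)

  enc : Vertex → Fin (suc (p + (q + q)))
  enc hub     = zero
  enc (rim r) = suc (rimCode r)

  dec : Fin (suc (p + (q + q))) → Vertex
  dec zero    = hub
  dec (suc i) = rim (rimAt i)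

  dec-enc : ∀ x → dec (enc x) ≡ x
  dec-enc hub     = refl
  dec-enc (rim r) = cong rim (rimAt-rimCode r)

  enc-dec : ∀ u → enc (dec u) ≡ u
  enc-dec zero    = refl
  enc-dec (suc i) = cong suc (rimCode-rimAt i)

  open Enumerated enc dec dec-enc enc-dec adj adj-sym adj-irr public

  rims-distinct : ∀ {u v r s} → dec u ≡ rim r → dec v ≡ rim s → u ≢ v → r ≢ s
  rims-distinct du dv u≢v r≡s = u≢v (dec-injective (trans du (trans (cong rim r≡s) (sym dv))))

  hub-unique : ∀ {u v} → dec u ≡ hub → dec v ≡ hub → u ≡ v
  hub-unique du dv = dec-injective (trans du (sym dv))

  module ConeColouring {k} (ρ ε : Fin (suc k)) (τ : Rim → Fin k) where

    vc : Vertex → Fin (suc k)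
    vc hub     = zero
    vc (rim _) = ρ

    ec : Vertex → Vertex → Fin (suc k)
    ec hub     hub     = ε
    ec hub     (rim r) = suc (τ r)
    ec (rim r) hub     = suc (τ r)
    ec (rim _) (rim _) = ε

    ec-sym : ∀ x y → ec x y ≡ ec y x
    ec-sym hub     hub     = refl
    ec-sym hub     (rim _) = refl
    ec-sym (rim _) hub     = refl
    ec-sym (rim _) (rim _) = refl

    open Coloured vc ec ec-sym public

    viaHub : ∀ {u v r s} → dec u ≡ rim r → dec v ≡ rim s → r ≢ s → τ r ≢ τ s →
             RainbowPath colouring u v 2
    viaHub du dv r≢s τr≢τs =
      hop2 hub du dv refl refl (r≢s ∘ rim-injective)
           (((τr≢τs ∘ suc-injective) ∷ (λ ()) ∷ []) ∷ ((λ ()) ∷ []) ∷ [] ∷ [])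

    hubThenRim : ∀ {u v r s} t → dec u ≡ rim r → dec v ≡ rim s → rimAdj t s ≡ true →
                 r ≢ t → r ≢ s → Unique (suc (τ r) ∷ suc (τ t) ∷ ε ∷ zero ∷ ρ ∷ []) →
                 RainbowPath colouring u v 3
    hubThenRim t du dv e r≢t r≢s =
      hop3 hub (rim t) du dv refl refl e (r≢t ∘ rim-injective) (λ ()) (r≢s ∘ rim-injective)

    rimThenHub : ∀ {u v r s} t → dec u ≡ rim r → dec v ≡ rim s → rimAdj r t ≡ true →
                 t ≢ s → r ≢ s → Unique (ε ∷ suc (τ t) ∷ suc (τ s) ∷ ρ ∷ zero ∷ []) →
                 RainbowPath colouring u v 3
    rimThenHub t du dv e t≢s r≢s =
      hop3 (rim t) hub du dv e refl refl (λ ()) (t≢s ∘ rim-injective) (r≢s ∘ rim-injective)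

  -- The strong colouring: every vertex and rim edge gets colour 0, and the spokes get
  -- p + q further colours, one per leaf and one per rim edge (shared by its two ends).
  slot : Rim → Fin p ⊎ Fin q
  slot (leaf j)  = inj₁ j
  slot (left i)  = inj₂ i
  slot (right i) = inj₂ i

  slot-separates : ∀ r s → slot r ≡ slot s → r ≡ s ⊎ rimAdj r s ≡ true
  slot-separates (leaf _)  (leaf _)  refl = inj₁ refl
  slot-separates (leaf _)  (left _)  ()
  slot-separates (leaf _)  (right _) ()
  slot-separates (left _)  (leaf _)  ()
  slot-separates (left _)  (left _)  refl = inj₁ refl
  slot-separates (left i)  (right _) refl = inj₂ (partner-lr i)
  slot-separates (right _) (leaf _)  ()
  slot-separates (right i) (left _)  refl = inj₂ (partner-rl i)
  slot-separates (right _) (right _) refl = inj₁ refl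

  module Strong = ConeColouring {p + q} zero zero (join p q ∘ slot)

  -- Adjacent vertices are joined by their edge, the others through the hub.
  strong-connected : StronglyTotalRainbowConnected Strong.colouring
  strong-connected u v with u ≟ v
  ... | yes refl = rainbow-geodesic (trivialPath Strong.colouring u) (λ _ → z≤n)
  ... | no u≢v with dec u in du | dec v in dv
  ...   | hub   | hub   = ⊥-elim (u≢v (hub-unique du dv))
  ...   | hub   | rim _ = rainbow-geodesic (Strong.hop du dv refl) (λ w → len-distinct w u≢v)
  ...   | rim _ | hub   = rainbow-geodesic (Strong.hop du dv refl) (λ w → len-distinct w u≢v)
  ...   | rim r | rim s with rimAdj r s in rs
  ...     | true  = rainbow-geodesic (Strong.hop du dv rs) (λ w → len-distinct w u≢v)
  ...     | false = rainbow-geodesic (Strong.viaHub du dv r≢s slots-differ)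
                                     (λ w → len-nonadjacent w u≢v (trans (cong₂ adj du dv) rs))
    where
    r≢s : r ≢ s
    r≢s = rims-distinct du dv u≢v

    slots-differ : join p q (slot r) ≢ join p q (slot s)
    slots-differ eq with slot-separates r s (join-injective p q eq)
    ... | inj₁ r≡s = r≢s r≡s
    ... | inj₂ adjacent with trans (sym rs) adjacent
    ...   | ()

-- Lower bounds on the cone with p ≥ 2 leaves.

module ConeLowerBounds (p′ q : ℕ) where
  open Cone (2 + p′) q

  leafVertex : Fin (2 + p′) → Fin (n graph)
  leafVertex j = enc (rim (leaf j))

  leaf-pendant : ∀ j → PendantAt (enc hub) (leafVertex j)
  leaf-pendant j = pendant-enc {x = rim (leaf j)} λ { hub _ → refl ; (rim _) () }

  trc-lower : ∀ k → k < 3 + p′ → (c : TotalColouring graph k) → ¬ TotalRainbowConnected c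
  trc-lower k k<p+1 c rc = <⇒≱ k<p+1 (hub-colour-bound c (enc hub) leafVertex leaves-via-hub)
    where
    leaves-via-hub : ∀ i j → i ≢ j → Unique (hubColours c (leafVertex i) (enc hub) (leafVertex j))
    leaves-via-hub i j i≢j =
      pendant-hub-rainbow c rc (leaf-pendant i) (leaf-pendant j)
        (λ eq → i≢j (leaf-injective (enc-injective eq)))
      where
      leaf-injective : ∀ {i j} → rim (leaf i) ≡ rim (leaf j) → i ≡ j
      leaf-injective refl = refl

  spokeEnd : Fin (2 + p′) ⊎ Fin q → Rim
  spokeEnd (inj₁ j) = leaf j
  spokeEnd (inj₂ i) = left i

  spokeEnd-injective : ∀ {a b} → rim (spokeEnd a) ≡ rim (spokeEnd b) → a ≡ b
  spokeEnd-injective {inj₁ _} {inj₁ _} refl = refl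
  spokeEnd-injective {inj₁ _} {inj₂ _} ()
  spokeEnd-injective {inj₂ _} {inj₁ _} ()
  spokeEnd-injective {inj₂ _} {inj₂ _} refl = refl

  spokeEnds-nonadjacent : ∀ a b → adj (rim (spokeEnd a)) (rim (spokeEnd b)) ≡ false
  spokeEnds-nonadjacent (inj₁ _) _        = refl
  spokeEnds-nonadjacent (inj₂ _) (inj₁ _) = refl
  spokeEnds-nonadjacent (inj₂ _) (inj₂ _) = refl

  spokeEnds-onlyHub : ∀ a b → a ≢ b → ∀ z → adj (rim (spokeEnd a)) z ≡ true →
                      adj z (rim (spokeEnd b)) ≡ true → z ≡ hub
  spokeEnds-onlyHub _        _        _   hub               _  _  = refl
  spokeEnds-onlyHub (inj₁ _) _        _   (rim _)           () _
  spokeEnds-onlyHub (inj₂ _) _        _   (rim (leaf _))    () _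
  spokeEnds-onlyHub (inj₂ _) _        _   (rim (left _))    () _
  spokeEnds-onlyHub (inj₂ _) (inj₁ _) _   (rim (right _))   _  ()
  spokeEnds-onlyHub (inj₂ _) (inj₂ _) a≢b (rim (right _))   e₁ e₂ =
    ⊥-elim (a≢b (cong inj₂ (trans (≟-sound e₁) (≟-sound e₂))))

  spokeVertex : Fin (2 + p′ + q) → Fin (n graph)
  spokeVertex t = enc (rim (spokeEnd (splitAt (2 + p′) t)))

  strc-lower : ∀ k → k < 3 + p′ + q → (c : TotalColouring graph k) →
               ¬ StronglyTotalRainbowConnected c
  strc-lower k k<p+q+1 c src = <⇒≱ k<p+q+1 (hub-colour-bound c (enc hub) spokeVertex spokes-via-hub)
    where
    spokes-via-hub : ∀ t t′ → t ≢ t′ →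
                     Unique (hubColours c (spokeVertex t) (enc hub) (spokeVertex t′))
    spokes-via-hub t t′ t≢t′ =
      geodesic-hub-rainbow c src
        (λ eq → t≢t′ (splitAt-injective (2 + p′) (spokeEnd-injective (enc-injective eq))))
        (trans (E-enc (rim (spokeEnd a)) (rim (spokeEnd b))) (spokeEnds-nonadjacent a b))
        (E-enc (rim (spokeEnd a)) hub) (E-enc hub (rim (spokeEnd b)))
        (commonNeighbour-enc {x = rim (spokeEnd a)} {y = rim (spokeEnd b)}
           (spokeEnds-onlyHub a b (t≢t′ ∘ splitAt-injective (2 + p′))))
      where
      a = splitAt (2 + p′) t
      b = splitAt (2 + p′) t′

-- A total-rainbow-connecting colouring of the cone with p ≥ 4 leaves using p + 1 colours.

module TrcColouring (p′ q : ℕ) where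
  open Cone (4 + p′) q

  -- Leaf j gets spoke colour 1 + j; left ends share colour 1 with leaf 0 and right ends
  -- colour 2 with leaf 1.  Rim vertices are coloured 4 and rim edges 3.
  τ : Rim → Fin (4 + p′)
  τ (leaf j)  = j
  τ (left _)  = zero
  τ (right _) = suc zero

  open ConeColouring (# 4) (# 3) τ public

  Connection : Fin (n graph) → Fin (n graph) → Set
  Connection u v = ∃[ w ] (IsPath {graph} {u} {v} w × TotalRainbow colouring w)

  -- Distinct rim vertices: through the hub, unless both spokes have the same colour;
  -- then through the hub and the rim edge at the end having one.
  rimRoute : ∀ {u v} r s → dec u ≡ rim r → dec v ≡ rim s → r ≢ s → Connection u v
  rimRoute (leaf _) (leaf _) du dv r≢s = rainbow-path (viaHub du dv r≢s (r≢s ∘ cong leaf))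
  rimRoute (leaf zero) (left i) du dv r≢s =
    rainbow-path (hubThenRim (right i) du dv (partner-rl i) (λ ()) r≢s (distinct _))
  rimRoute (leaf zero)             (right _) du dv r≢s = rainbow-path (viaHub du dv r≢s (λ ()))
  rimRoute (leaf (suc zero))       (left _)  du dv r≢s = rainbow-path (viaHub du dv r≢s (λ ()))
  rimRoute (leaf (suc zero)) (right i) du dv r≢s =
    rainbow-path (hubThenRim (left i) du dv (partner-lr i) (λ ()) r≢s (distinct _))
  rimRoute (leaf (suc (suc _)))    (left _)  du dv r≢s = rainbow-path (viaHub du dv r≢s (λ ()))
  rimRoute (leaf (suc (suc _)))    (right _) du dv r≢s = rainbow-path (viaHub du dv r≢s (λ ()))
  rimRoute (left i) (leaf zero) du dv r≢s =
    rainbow-path (rimThenHub (right i) du dv (partner-lr i) (λ ()) r≢s (distinct _))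
  rimRoute (left _)  (leaf (suc zero))    du dv r≢s = rainbow-path (viaHub du dv r≢s (λ ()))
  rimRoute (left _)  (leaf (suc (suc _))) du dv r≢s = rainbow-path (viaHub du dv r≢s (λ ()))
  rimRoute (right _) (leaf zero)          du dv r≢s = rainbow-path (viaHub du dv r≢s (λ ()))
  rimRoute (right i) (leaf (suc zero)) du dv r≢s =
    rainbow-path (rimThenHub (left i) du dv (partner-rl i) (λ ()) r≢s (distinct _))
  rimRoute (right _) (leaf (suc (suc _))) du dv r≢s = rainbow-path (viaHub du dv r≢s (λ ()))
  rimRoute (left _) (left j) du dv r≢s =
    rainbow-path (hubThenRim (right j) du dv (partner-rl j) (λ ()) r≢s (distinct _))
  rimRoute (right _) (right j) du dv r≢s =
    rainbow-path (hubThenRim (left j) du dv (partner-lr j) (λ ()) r≢s (distinct _))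
  rimRoute (left _)  (right _) du dv r≢s = rainbow-path (viaHub du dv r≢s (λ ()))
  rimRoute (right _) (left _)  du dv r≢s = rainbow-path (viaHub du dv r≢s (λ ()))

  trc-connected : TotalRainbowConnected colouring
  trc-connected u v with u ≟ v
  ... | yes refl = rainbow-path (trivialPath colouring u)
  ... | no u≢v with dec u in du | dec v in dv
  ...   | hub   | hub   = ⊥-elim (u≢v (hub-unique du dv))
  ...   | hub   | rim _ = rainbow-path (hop du dv refl)
  ...   | rim _ | hub   = rainbow-path (hop du dv refl)
  ...   | rim r | rim s = rimRoute r s du dv (rims-distinct du dv u≢v)

cone-realises : ∀ p′ q → let G = Cone.graph (4 + p′) q in
                Connected G × trcIs G (5 + p′) × strcIs G (5 + p′ + q)
cone-realises p′ q =
  Walks.rainbow⇒connected _ {c = Trc.colouring} Trc.trc-connected ,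
  ((Trc.colouring , Trc.trc-connected) , Lower.trc-lower) ,
  ((Cone.Strong.colouring (4 + p′) q , Cone.strong-connected (4 + p′) q) , Lower.strc-lower)
  where
  module Trc   = TrcColouring p′ q
  module Lower = ConeLowerBounds (2 + p′) q

lemma4p10 : (a b : ℕ) → 5 ≤ a → a < b →
    Σ Graph (λ G → Connected G × trcIs G a × strcIs G b)
lemma4p10 a b (s≤s (s≤s (s≤s (s≤s (s≤s (z≤n {p′})))))) a<b with m≤n⇒∃[o]m+o≡n (<⇒≤ a<b)
... | q , refl = Cone.graph (4 + p′) q , cone-realises p′ q
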